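{- Let $H\in M_N(\pm1)$ be an Hadamard matrix of order $N\ge4$, with glow $\mu$ (a probability measure supported on $4\mathbb{Z}$), and let $\mu^{even},\mu^{odd}$ be the mass-one rescaled restrictions of $\mu$ to $8\mathbb{Z}$ and to $8\mathbb{Z}+4$ respectively. (1) If $N\equiv 0\pmod 8$ then $\mu=\frac34\mu^{even}+\frac14\mu^{odd}$. (2) If $N\equiv 4\pmod 8$ then $\mu=\frac14\mu^{even}+\frac34\mu^{odd}$.
   Context: An Hadamard matrix is a square matrix $H\in M_N(\pm1)$ whose rows are pairwise orthogonal in $\mathbb{R}^N$. The glow of $H$ is the probability measure $\mu$ on $\mathbb{Z}$ which is the law of the random variable $\varphi(a,b)=\sum_{i,j}a_ib_jH_{ij}$, where $(a,b)$ is uniformly distributed on $\{\pm1\}^N\times\{\pm1\}^N$; equivalently, the distribution of the sum of entries over the matrices obtained from $H$ by switching signs of rows and columns. -}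

module Defs where

open import Data.Bool using (Bool; true; false; _∧_; if_then_else_)
open import Data.Nat as ℕ using (ℕ; zero; suc)
import Data.Nat.Properties as ℕP
open import Data.Integer as ℤ using (ℤ; +_; -[1+_]; _*_; _+_)
open import Data.Integer.DivMod using (_%ℕ_)
open import Data.Fin using (Fin; zero; suc)
open import Data.List using (List; []; _∷_; length; filterᵇ; concatMap; cartesianProduct)
open import Data.Product using (_×_; _,_)
open import Data.Sum using (_⊎_)
open import Data.Rational as ℚ using (ℚ; 0ℚ; _≟_)
open import Relation.Binary.PropositionalEquality using (_≡_; _≢_)
open import Relation.Nullary using (yes; no; does)

Σ : ∀ n → (Fin n → ℤ) → ℤ
Σ zero    f = + 0
Σ (suc n) f = f zero + Σ n (λ i → f (suc i))

Matrix : ℕ → Set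
Matrix N = Fin N → Fin N → ℤ

IsHadamard : ∀ N → Matrix N → Set
IsHadamard N H =
  (∀ i j → H i j ≡ + 1 ⊎ H i j ≡ -[1+ 0 ]) ×
  (∀ i j → i ≢ j → Σ N (λ k → H i k * H j k) ≡ + 0)

SignVec : ℕ → Set
SignVec n = Fin n → ℤ

cons : ∀ {n} → ℤ → SignVec n → SignVec (suc n)
cons x v zero    = x
cons x v (suc i) = v i

allSigns : ∀ n → List (SignVec n)
allSigns zero    = (λ ()) ∷ []
allSigns (suc n) = concatMap (λ v → cons (+ 1) v ∷ cons -[1+ 0 ] v ∷ []) (allSigns n)

φ : ∀ {N} → Matrix N → SignVec N × SignVec N → ℤ
φ {N} H (a , b) = Σ N (λ i → Σ N (λ j → a i * b j * H i j))

-- Subsets of ℤ given by Boolean predicates; a (finite-support) measure on ℤ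
-- is represented by its values on such subsets.
Subset : Set
Subset = ℤ → Bool

_∩_ : Subset → Subset → Subset
(S ∩ T) k = S k ∧ T k

Measure : Set
Measure = Subset → ℚ

count : ∀ {N} → Matrix N → Subset → ℕ
count {N} H S = length (filterᵇ (λ p → S (φ H p)) (cartesianProduct (allSigns N) (allSigns N)))

-- The glow: law of φ(a,b) for (a,b) uniform on {±1}^N × {±1}^N
glow : ∀ {N} → Matrix N → Measure
glow {N} H S = (+ count H S ℚ./ (4 ℕ.^ N)) {{ℕP.m^n≢0 4 N}}

-- Mass-one rescaling of the restriction of μ to E: S ↦ μ(S ∩ E) / μ(E)
-- (convention: zero measure if μ(E) = 0; this case does not occur in the theorem)
restrictRescale : Measure → Subset → Measure
restrictRescale μ E S with μ E ≟ 0ℚ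
... | yes _  = 0ℚ
... | no μE≢0 = (μ (S ∩ E) ℚ.÷ μ E) {{ℚ.≢-nonZero μE≢0}}

eight0 : Subset
eight0 k = does (k %ℕ 8 ℕ.≟ 0)

eight4 : Subset
eight4 k = does (k %ℕ 8 ℕ.≟ 4)

μeven : ∀ {N} → Matrix N → Measure
μeven H = restrictRescale (glow H) eight0

μodd : ∀ {N} → Matrix N → Measure
μodd H = restrictRescale (glow H) eight4

module Submission where

-- Let a, b ∈ {±1}^N and let t = aH be the signed column sums, so that φ(a,b) = b·t.
-- From H Hᵀ = N·I we first get Hᵀ H = N·I (comparing sums of squares).  Then all t_j
-- are even and pairwise congruent modulo 4, so φ(a,b) ≡ N·t₀ ≡ 0 (mod 4).  If t₀ ≡ 0
-- (mod 4), the identity Σ t_j² = N² forces Σ t_j ≡ N (mod 8), and every φ(a,b) ≡ N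
-- (mod 8).  If t₀ ≡ 2 (mod 4), flipping b₀ moves φ by 2t₀ ≡ 4 (mod 8), so the b split
-- evenly between 8ℤ and 8ℤ + 4.  Flipping a₀ exchanges the two cases.  Hence the class
-- of N modulo 8 receives 3/4 of the 4^N pairs (a,b) and the other class 1/4; since the
-- glow is carried by 8ℤ ∪ (8ℤ + 4), it is the corresponding mixture of its rescaled
-- restrictions.

open import Defs

module GlowOfHadamardMatrices where

  open import Data.Nat as ℕ using (ℕ; zero; suc; NonZero)
  import Data.Nat.Properties as ℕP
  import Data.Nat.Divisibility as ℕDiv
  import Data.Nat.DivMod as ℕDivMod
  open import Data.Integer as ℤ using (ℤ; +_; -[1+_]; 0ℤ; _+_; _-_; _*_; -_; ∣_∣)
  import Data.Integer.Properties as ℤP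
  open import Data.Integer.Divisibility.Signed
    using (_∣_; divides; _∣?_; ∣-trans; ∣⇒∣ᵤ; ∣m∣n⇒∣m+n; ∣m⇒∣-m; ∣n⇒∣m*n; *-monoʳ-∣; *-cancelˡ-∣)
  open import Data.Integer.DivMod using (_%ℕ_; _/ℕ_; a≡a%ℕn+[a/ℕn]*n; n%ℕd<d)
  open import Data.Integer.Tactic.RingSolver using (solve-∀)
  open import Data.Integer.GCD using (gcd)
  open import Data.Fin as Fin using (Fin; zero; suc; punchIn; punchOut)
  open import Data.Fin.Properties using (punchInᵢ≢i; punchIn-punchOut)
  open import Data.Sum using (_⊎_; inj₁; inj₂; reduce)
  open import Data.Product using (_,_)
  open import Data.Bool using (Bool; true; false; _∧_)
  open import Data.List using (List; []; _∷_; _++_; map; length; filterᵇ; cartesianProduct; concatMap)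
  open import Data.List.Relation.Unary.All using (All; []; _∷_)
  import Data.Nat.Tactic.RingSolver as ℕSolver
  open import Data.Rational as ℚ using (0ℚ; toℚᵘ)
  import Data.Rational.Properties as ℚP
  open import Data.Rational.Unnormalised as ℚᵘ using (mkℚᵘ; *≡*)
  import Data.Rational.Unnormalised.Properties as ℚᵘP
  open import Function using (_∘_)
  open import Relation.Binary.Bundles using (Setoid)
  import Relation.Binary.Reasoning.Setoid
  open import Relation.Binary.PropositionalEquality
  open import Relation.Nullary using (yes; no; does)
  open import Relation.Nullary.Decidable using (True; toWitness)
  open import Relation.Nullary.Negation using (contradiction)
  open import Algebra.Properties.Semiring.Sum ℤP.+-*-semiring
    using (sum-syntax; sum-cong-≗; ∑-comm; ∑-distrib-+; *-distribˡ-sum; *-distribʳ-sum; sum-remove)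
  open import Algebra.Properties.AbelianGroup ℤP.+-0-abelianGroup using (identityʳ-unique)
  open import Algebra.Properties.Ring ℤP.+-*-ring using (x[y-z]≈xy-xz)

  -- Defs sums over Fin n with its own Σ; it agrees with the standard library's ∑,
  -- whose algebraic lemmas (commutation, distributivity, ...) we use throughout.
  Σ≡∑ : ∀ n (f : Fin n → ℤ) → Σ n f ≡ ∑[ i < n ] f i
  Σ≡∑ zero    f = refl
  Σ≡∑ (suc n) f = cong (_+_ (f zero)) (Σ≡∑ n (f ∘ suc))

  ∑-const : ∀ n c → ∑[ i < n ] c ≡ + n * c
  ∑-const zero    c = refl
  ∑-const (suc n) c = begin
    c + ∑[ i < n ] c   ≡⟨ cong (_+_ c) (∑-const n c) ⟩
    c + + n * c        ≡⟨ cong (_+ + n * c) (ℤP.*-identityˡ c) ⟨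
    + 1 * c + + n * c  ≡⟨ ℤP.*-distribʳ-+ c (+ 1) (+ n) ⟨
    + suc n * c        ∎
    where open ≡-Reasoning

  ∑-δ : ∀ {n} (f : Fin n → ℤ) i → (∀ k → k ≢ i → f k ≡ 0ℤ) → ∑[ k < n ] f k ≡ f i
  ∑-δ {suc n} f i off-i = begin
    ∑[ k < suc n ] f k                      ≡⟨ sum-remove {i = i} f ⟩
    f i + ∑[ k < n ] f (punchIn i k)        ≡⟨ cong (_+_ (f i)) (sum-cong-≗ (λ k → off-i _ (punchInᵢ≢i i k))) ⟩
    f i + ∑[ k < n ] 0ℤ                     ≡⟨ cong (_+_ (f i)) (trans (∑-const n 0ℤ) (ℤP.*-zeroʳ (+ n))) ⟩
    f i + 0ℤ                                ≡⟨ ℤP.+-identityʳ (f i) ⟩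
    f i                                     ∎
    where open ≡-Reasoning

  ∑*∑ : ∀ {m n} (f : Fin m → ℤ) (g : Fin n → ℤ) →
        (∑[ i < m ] f i) * (∑[ k < n ] g k) ≡ ∑[ i < m ] ∑[ k < n ] (f i * g k)
  ∑*∑ f g = trans (*-distribʳ-sum _ f) (sum-cong-≗ (λ i → *-distribˡ-sum (f i) g))

  infix 7 _·_
  _·_ : ∀ {n} → (Fin n → ℤ) → (Fin n → ℤ) → ℤ
  _·_ {n} u v = ∑[ i < n ] (u i * v i)

  square-nonneg : ∀ x → 0ℤ ℤ.≤ x * x
  square-nonneg (+ n)    = subst (0ℤ ℤ.≤_) (ℤP.pos-* n n) (ℤ.+≤+ ℕ.z≤n)
  square-nonneg -[1+ n ] = ℤ.+≤+ ℕ.z≤n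

  ∑-nonneg : ∀ {n} (f : Fin n → ℤ) → (∀ k → 0ℤ ℤ.≤ f k) → 0ℤ ℤ.≤ ∑[ k < n ] f k
  ∑-nonneg {zero}  f f≥0 = ℤP.≤-refl
  ∑-nonneg {suc n} f f≥0 = ℤP.+-mono-≤ (f≥0 zero) (∑-nonneg (f ∘ suc) (f≥0 ∘ suc))

  ∑-nonneg-zero : ∀ {n} (f : Fin n → ℤ) → (∀ k → 0ℤ ℤ.≤ f k) → ∑[ k < n ] f k ≡ 0ℤ → ∀ k → f k ≡ 0ℤ
  ∑-nonneg-zero {suc n} f f≥0 ∑f≡0 = λ where
      zero    → head≡0
      (suc k) → ∑-nonneg-zero (f ∘ suc) (f≥0 ∘ suc) tail≡0 k
    where
    tail≥0 : 0ℤ ℤ.≤ ∑[ k < n ] f (suc k)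
    tail≥0 = ∑-nonneg (f ∘ suc) (f≥0 ∘ suc)
    head≡0 : f zero ≡ 0ℤ
    head≡0 = ℤP.≤-antisym
      (subst (f zero ℤ.≤_) ∑f≡0 (ℤP.i≤i+j (f zero) _ {{ℤ.nonNegative tail≥0}}))
      (f≥0 zero)
    tail≡0 : ∑[ k < n ] f (suc k) ≡ 0ℤ
    tail≡0 = trans (sym (ℤP.+-identityˡ _)) (trans (cong (λ x → x + ∑[ k < n ] f (suc k)) (sym head≡0)) ∑f≡0)

  -- If the squares of the entries of f sum to the square of its i-th entry, every
  -- other entry vanishes: the remaining squares are nonnegative and sum to zero.
  squares-isolated : ∀ {n} (f : Fin n → ℤ) i → f · f ≡ f i * f i → ∀ k → k ≢ i → f k ≡ 0ℤ
  squares-isolated {suc n} f i f·f≡fᵢ² k k≢i =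
    square≡0⇒≡0 (rest-vanishes (punchOut (k≢i ∘ sym)))
    where
    square : Fin (suc n) → ℤ
    square j = f j * f j
    rest≡0 : ∑[ j < n ] square (punchIn i j) ≡ 0ℤ
    rest≡0 = identityʳ-unique (square i) _ (trans (sym (sum-remove {i = i} square)) f·f≡fᵢ²)
    rest-vanishes : ∀ j → square (punchIn i j) ≡ 0ℤ
    rest-vanishes = ∑-nonneg-zero (square ∘ punchIn i) (square-nonneg ∘ f ∘ punchIn i) rest≡0
    square≡0⇒≡0 : square (punchIn i (punchOut (k≢i ∘ sym))) ≡ 0ℤ → f k ≡ 0ℤ
    square≡0⇒≡0 eq =
      reduce (ℤP.i*j≡0⇒i≡0∨j≡0 (f k) (subst (λ j → square j ≡ 0ℤ) (punchIn-punchOut (k≢i ∘ sym)) eq))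

  -- Congruence modulo m: m divides the difference.  (A record, so that the two
  -- sides and the modulus can be recovered from the type.)
  infix 4 _≡_[mod_]
  record _≡_[mod_] (x y : ℤ) (m : ℕ) : Set where
    constructor congruent
    field divides-difference : + m ∣ x - y
  open _≡_[mod_]

  by-computation : ∀ {m x y} → True (+ m ∣? x - y) → x ≡ y [mod m ]
  by-computation t = congruent (toWitness t)

  mod-multiple : ∀ {m x y} k → x ≡ y + k * + m → x ≡ y [mod m ]
  mod-multiple {m} {x} {y} k x≡y+km = congruent (divides k (begin
    x - y              ≡⟨ cong (_- y) x≡y+km ⟩
    y + k * + m - y    ≡⟨ cancel y (k * + m) ⟩
    k * + m            ∎))
    where
    open ≡-Reasoning
    cancel : ∀ a b → a + b - a ≡ b
    cancel = solve-∀

  mod-reflexive : ∀ {m x y} → x ≡ y → x ≡ y [mod m ]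
  mod-reflexive {x = x} refl = mod-multiple (+ 0) (sym (ℤP.+-identityʳ x))

  mod-sym : ∀ {m x y} → x ≡ y [mod m ] → y ≡ x [mod m ]
  mod-sym {m} {x} {y} (congruent m∣x-y) = congruent (subst (+ m ∣_) (negate x y) (∣m⇒∣-m m∣x-y))
    where
    negate : ∀ a b → - (a - b) ≡ b - a
    negate = solve-∀

  mod-trans : ∀ {m x y z} → x ≡ y [mod m ] → y ≡ z [mod m ] → x ≡ z [mod m ]
  mod-trans {m} {x} {y} {z} (congruent m∣x-y) (congruent m∣y-z) =
    congruent (subst (+ m ∣_) (telescope x y z) (∣m∣n⇒∣m+n m∣x-y m∣y-z))
    where
    telescope : ∀ a b c → (a - b) + (b - c) ≡ a - c
    telescope = solve-∀

  mod-setoid : ℕ → Setoid _ _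
  mod-setoid m = record
    { Carrier = ℤ
    ; _≈_ = λ x y → x ≡ y [mod m ]
    ; isEquivalence = record
      { refl = mod-reflexive refl ; sym = mod-sym ; trans = mod-trans }
    }

  module ≡-mod-Reasoning (m : ℕ) = Relation.Binary.Reasoning.Setoid (mod-setoid m)

  mod-+ : ∀ {m x y u v} → x ≡ y [mod m ] → u ≡ v [mod m ] → x + u ≡ y + v [mod m ]
  mod-+ {m} {x} {y} {u} {v} (congruent m∣x-y) (congruent m∣u-v) =
    congruent (subst (+ m ∣_) (interchange x y u v) (∣m∣n⇒∣m+n m∣x-y m∣u-v))
    where
    interchange : ∀ a b c d → (a - b) + (c - d) ≡ (a + c) - (b + d)
    interchange = solve-∀

  mod-+ˡ : ∀ {m u v} c → u ≡ v [mod m ] → c + u ≡ c + v [mod m ]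
  mod-+ˡ c = mod-+ (mod-reflexive {x = c} refl)

  mod-+ʳ : ∀ {m u v} c → u ≡ v [mod m ] → u + c ≡ v + c [mod m ]
  mod-+ʳ c u≡v = mod-+ u≡v (mod-reflexive {x = c} refl)

  mod-*ˡ : ∀ {m x y} c → x ≡ y [mod m ] → c * x ≡ c * y [mod m ]
  mod-*ˡ {m} {x} {y} c (congruent m∣x-y) = congruent (subst (+ m ∣_) (x[y-z]≈xy-xz c x y) (∣n⇒∣m*n c m∣x-y))

  mod-*ʳ : ∀ {m x y} c → x ≡ y [mod m ] → x * c ≡ y * c [mod m ]
  mod-*ʳ {x = x} {y} c x≡y = subst₂ (λ u v → u ≡ v [mod _ ]) (ℤP.*-comm c x) (ℤP.*-comm c y) (mod-*ˡ c x≡y)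

  mod-scale : ∀ {m x y} c → x ≡ y [mod m ] → + c * x ≡ + c * y [mod c ℕ.* m ]
  mod-scale {m} {x} {y} c (congruent m∣x-y) =
    congruent (subst₂ _∣_ (sym (ℤP.pos-* c m)) (x[y-z]≈xy-xz (+ c) x y) (*-monoʳ-∣ (+ c) m∣x-y))

  mod-cancel : ∀ {m x y} c .{{_ : NonZero c}} → + c * x ≡ + c * y [mod c ℕ.* m ] → x ≡ y [mod m ]
  mod-cancel {m} {x} {y} c@(suc _) (congruent cm∣cx-cy) =
    congruent (*-cancelˡ-∣ (+ c) (subst₂ _∣_ (ℤP.pos-* c m) (sym (x[y-z]≈xy-xz (+ c) x y)) cm∣cx-cy))

  mod-weaken : ∀ {m x y} k → x ≡ y [mod k ℕ.* m ] → x ≡ y [mod m ]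
  mod-weaken {m} k (congruent km∣x-y) =
    congruent (∣-trans (divides (+ k) (ℤP.pos-* k m)) km∣x-y)

  ∑-mod : ∀ {m n} {f g : Fin n → ℤ} → (∀ i → f i ≡ g i [mod m ]) → ∑[ i < n ] f i ≡ ∑[ i < n ] g i [mod m ]
  ∑-mod {n = zero}  f≡g = mod-reflexive refl
  ∑-mod {n = suc n} f≡g = mod-+ (f≡g zero) (∑-mod (f≡g ∘ suc))

  multiple-of : ∀ {m x q} → x - 0ℤ ≡ q * + m → x ≡ + m * q
  multiple-of {m} {x} {q} x≡qm = trans (sym (ℤP.+-identityʳ x)) (trans x≡qm (ℤP.*-comm q (+ m)))

  mod-of-% : ∀ {n m r} .{{_ : NonZero m}} → n ℕ.% m ≡ r → + n ≡ + r [mod m ]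
  mod-of-% {n} {m} {r} n%m≡r = mod-multiple (+ (n ℕ./ m)) (begin
    + n                             ≡⟨ cong +_ (ℕDivMod.m≡m%n+[m/n]*n n m) ⟩
    + (n ℕ.% m ℕ.+ n ℕ./ m ℕ.* m)   ≡⟨ cong (λ s → + (s ℕ.+ n ℕ./ m ℕ.* m)) n%m≡r ⟩
    + (r ℕ.+ n ℕ./ m ℕ.* m)         ≡⟨ ℤP.pos-+ r _ ⟩
    + r + + (n ℕ./ m ℕ.* m)         ≡⟨ cong (_+_ (+ r)) (ℤP.pos-* (n ℕ./ m) m) ⟩
    + r + + (n ℕ./ m) * + m         ∎)
    where open ≡-Reasoning

  parity : ∀ x → x ≡ 0ℤ [mod 2 ] ⊎ x ≡ + 1 [mod 2 ]
  parity x with x %ℕ 2 | a≡a%ℕn+[a/ℕn]*n x 2 | n%ℕd<d x 2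
  ... | 0           | x≡r+q2 | _ = inj₁ (mod-multiple (x /ℕ 2) x≡r+q2)
  ... | 1           | x≡r+q2 | _ = inj₂ (mod-multiple (x /ℕ 2) x≡r+q2)
  ... | suc (suc _) | _      | ℕ.s≤s (ℕ.s≤s ())

  square-mod-2 : ∀ x → x * x ≡ x [mod 2 ]
  square-mod-2 x with parity x
  ... | inj₁ x≡0 = begin
    x * x   ≈⟨ mod-*ˡ x x≡0 ⟩
    x * 0ℤ  ≡⟨ ℤP.*-zeroʳ x ⟩
    0ℤ      ≈⟨ mod-sym x≡0 ⟩
    x       ∎
    where open ≡-mod-Reasoning 2
  ... | inj₂ x≡1 = begin
    x * x   ≈⟨ mod-*ˡ x x≡1 ⟩
    x * + 1 ≡⟨ ℤP.*-identityʳ x ⟩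
    x       ∎
    where open ≡-mod-Reasoning 2

  mod-split : ∀ m {x} → x ≡ 0ℤ [mod m ] → x ≡ 0ℤ [mod m ℕ.* 2 ] ⊎ x ≡ + m [mod m ℕ.* 2 ]
  mod-split m {x} (congruent (divides q x≡qm)) = by-parity-of-q (parity q)
    where
    open ≡-mod-Reasoning (m ℕ.* 2)
    x≡mq : x ≡ + m * q
    x≡mq = multiple-of x≡qm
    by-parity-of-q : q ≡ 0ℤ [mod 2 ] ⊎ q ≡ + 1 [mod 2 ] → x ≡ 0ℤ [mod m ℕ.* 2 ] ⊎ x ≡ + m [mod m ℕ.* 2 ]
    by-parity-of-q (inj₁ q≡0) = inj₁ (begin
      x         ≡⟨ x≡mq ⟩
      + m * q   ≈⟨ mod-scale m q≡0 ⟩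
      + m * 0ℤ  ≡⟨ ℤP.*-zeroʳ (+ m) ⟩
      0ℤ        ∎)
    by-parity-of-q (inj₂ q≡1) = inj₂ (begin
      x         ≡⟨ x≡mq ⟩
      + m * q   ≈⟨ mod-scale m q≡1 ⟩
      + m * + 1 ≡⟨ ℤP.*-identityʳ (+ m) ⟩
      + m       ∎)

  square-of-multiple : ∀ m {x} → x ≡ 0ℤ [mod m ] → x * x ≡ + m * x [mod m ℕ.* m ℕ.* 2 ]
  square-of-multiple m {x} (congruent (divides q x≡qm)) = begin
    x * x                   ≡⟨ cong₂ _*_ x≡mq x≡mq ⟩
    + m * q * (+ m * q)     ≡⟨ regroup (+ m) q ⟩
    + m * + m * (q * q)     ≡⟨ cong (_* (q * q)) (sym (ℤP.pos-* m m)) ⟩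
    + (m ℕ.* m) * (q * q)   ≈⟨ mod-scale (m ℕ.* m) (square-mod-2 q) ⟩
    + (m ℕ.* m) * q         ≡⟨ cong (_* q) (ℤP.pos-* m m) ⟩
    + m * + m * q           ≡⟨ ℤP.*-assoc (+ m) (+ m) q ⟩
    + m * (+ m * q)         ≡⟨ cong (+ m *_) x≡mq ⟨
    + m * x                 ∎
    where
    open ≡-mod-Reasoning (m ℕ.* m ℕ.* 2)
    x≡mq : x ≡ + m * q
    x≡mq = multiple-of x≡qm
    regroup : ∀ a b → a * b * (a * b) ≡ a * a * (b * b)
    regroup = solve-∀

  -- The remainder of x modulo m is the unique r < m congruent to x: the distance
  -- between the remainder and r is a multiple of m smaller than m, hence 0.
  residue : ∀ {m x r} .{{_ : NonZero m}} → r ℕ.< m → x ≡ + r [mod m ] → x %ℕ m ≡ r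
  residue {m} {x} {r} r<m x≡r = ℤP.+-injective (ℤP.i-j≡0⇒i≡j _ _ (ℤP.∣i∣≡0⇒i≡0 (small-multiple distance<m m∣distance)))
    where
    s : ℕ
    s = x %ℕ m
    s≡r : + s ≡ + r [mod m ]
    s≡r = mod-trans (mod-sym (mod-multiple (x /ℕ m) (a≡a%ℕn+[a/ℕn]*n x m))) x≡r
    m∣distance : m ℕDiv.∣ ∣ + s - + r ∣
    m∣distance = ∣⇒∣ᵤ (divides-difference s≡r)
    distance<m : ∣ + s - + r ∣ ℕ.< m
    distance<m = ℕP.≤-<-trans (ℕP.≤-reflexive (cong ∣_∣ (ℤP.m-n≡m⊖n s r)))
                   (ℕP.≤-<-trans (ℤP.∣m⊝n∣≤m⊔n s r) (ℕP.⊔-lub (n%ℕd<d x m) r<m))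
    small-multiple : ∀ {d} → d ℕ.< m → m ℕDiv.∣ d → d ≡ 0
    small-multiple {zero}  _   _   = refl
    small-multiple {suc d} d<m m∣d = contradiction m∣d (ℕDiv.>⇒∤ d<m)

  IsSign : ℤ → Set
  IsSign x = x ≡ + 1 ⊎ x ≡ -[1+ 0 ]

  IsSignVec : ∀ {n} → SignVec n → Set
  IsSignVec v = ∀ i → IsSign (v i)

  sign-* : ∀ {x y} → IsSign x → IsSign y → IsSign (x * y)
  sign-* (inj₁ refl) (inj₁ refl) = inj₁ refl
  sign-* (inj₁ refl) (inj₂ refl) = inj₂ refl
  sign-* (inj₂ refl) (inj₁ refl) = inj₂ refl
  sign-* (inj₂ refl) (inj₂ refl) = inj₁ refl

  sign-square : ∀ {x} → IsSign x → x * x ≡ + 1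
  sign-square (inj₁ refl) = refl
  sign-square (inj₂ refl) = refl

  sign-odd : ∀ {x} → IsSign x → x ≡ + 1 [mod 2 ]
  sign-odd (inj₁ refl) = by-computation _
  sign-odd (inj₂ refl) = by-computation _

  -- Changing the sign of a multiple x of m changes it by 2x ≡ 0 modulo 2m.
  sign-mod : ∀ {m b x} → IsSign b → x ≡ 0ℤ [mod m ] → b * x ≡ x [mod m ℕ.* 2 ]
  sign-mod (inj₁ refl) _ = mod-reflexive (ℤP.*-identityˡ _)
  sign-mod {m} {x = x} (inj₂ refl) (congruent (divides q x≡qm)) = mod-multiple (- q) (begin
    -[1+ 0 ] * x                    ≡⟨ cong (-[1+ 0 ] *_) x≡mq ⟩
    -[1+ 0 ] * (+ m * q)            ≡⟨ negate (+ m) q ⟩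
    + m * q + - q * (+ m * + 2)     ≡⟨ cong₂ (λ y z → y + - q * z) (sym x≡mq) (sym (ℤP.pos-* m 2)) ⟩
    x + - q * + (m ℕ.* 2)           ∎)
    where
    open ≡-Reasoning
    x≡mq : x ≡ + m * q
    x≡mq = multiple-of x≡qm
    negate : ∀ a b → -[1+ 0 ] * (a * b) ≡ a * b + - b * (a * + 2)
    negate = solve-∀

  -- For signs, xy + yz ≡ xz + 1 (mod 4); summed down two columns of H it compares
  -- their signed sums.
  signs-mod-4 : ∀ {x y z} → IsSign x → IsSign y → IsSign z → x * y + y * z ≡ x * z + + 1 [mod 4 ]
  signs-mod-4 (inj₁ refl) (inj₁ refl) (inj₁ refl) = by-computation _
  signs-mod-4 (inj₁ refl) (inj₁ refl) (inj₂ refl) = by-computation _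
  signs-mod-4 (inj₁ refl) (inj₂ refl) (inj₁ refl) = by-computation _
  signs-mod-4 (inj₁ refl) (inj₂ refl) (inj₂ refl) = by-computation _
  signs-mod-4 (inj₂ refl) (inj₁ refl) (inj₁ refl) = by-computation _
  signs-mod-4 (inj₂ refl) (inj₁ refl) (inj₂ refl) = by-computation _
  signs-mod-4 (inj₂ refl) (inj₂ refl) (inj₁ refl) = by-computation _
  signs-mod-4 (inj₂ refl) (inj₂ refl) (inj₂ refl) = by-computation _

  double-sign : ∀ {h} → IsSign h → + 2 * h ≡ + 2 [mod 4 ]
  double-sign (inj₁ refl) = by-computation _
  double-sign (inj₂ refl) = by-computation _

  dot-signs : ∀ {n} {u : SignVec n} → IsSignVec u → u · u ≡ + n
  dot-signs {n} {u} u-signs = begin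
    ∑[ i < n ] (u i * u i)   ≡⟨ sum-cong-≗ (sign-square ∘ u-signs) ⟩
    ∑[ i < n ] (+ 1)         ≡⟨ ∑-const n (+ 1) ⟩
    + n * + 1                ≡⟨ ℤP.*-identityʳ (+ n) ⟩
    + n                      ∎
    where open ≡-Reasoning

  flip-first : ∀ {n} (v : SignVec n) (t : Fin (suc n) → ℤ) →
               cons (+ 1) v · t ≡ cons -[1+ 0 ] v · t + + 2 * t zero
  flip-first {n} v t = flip (t zero) (∑[ i < n ] (v i * t (suc i)))
    where
    flip : ∀ t₀ r → + 1 * t₀ + r ≡ -[1+ 0 ] * t₀ + r + + 2 * t₀
    flip = solve-∀

  module HadamardAlgebra {N} (H : Matrix N)
           (entry-sign : ∀ i j → IsSign (H i j))
           (rows-orthogonal : ∀ i m → i ≢ m → Σ N (λ k → H i k * H m k) ≡ 0ℤ) where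

    column : Fin N → SignVec N
    column j i = H i j

    combine : (Fin N → ℤ) → Fin N → ℤ
    combine u j = ∑[ i < N ] (u i * H i j)

    row-norm : ∀ i → H i · H i ≡ + N
    row-norm i = dot-signs (entry-sign i)

    -- H Hᵀ = N·I turns inner products of row combinations into inner products of coefficients.
    combine-inner : ∀ u v → combine u · combine v ≡ + N * (u · v)
    combine-inner u v = begin
      ∑[ j < N ] (combine u j * combine v j)
        ≡⟨ sum-cong-≗ (λ j → ∑*∑ (λ i → u i * H i j) (λ m → v m * H m j)) ⟩
      ∑[ j < N ] ∑[ i < N ] ∑[ m < N ] (u i * H i j * (v m * H m j))
        ≡⟨ ∑-comm (λ j i → ∑[ m < N ] term i j m) ⟩
      ∑[ i < N ] ∑[ j < N ] ∑[ m < N ] (u i * H i j * (v m * H m j))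
        ≡⟨ sum-cong-≗ (λ i → ∑-comm (term i)) ⟩
      ∑[ i < N ] ∑[ m < N ] ∑[ j < N ] (u i * H i j * (v m * H m j))
        ≡⟨ sum-cong-≗ (λ i → sum-cong-≗ (factor i)) ⟩
      ∑[ i < N ] ∑[ m < N ] (u i * v m * (H i · H m))
        ≡⟨ sum-cong-≗ (λ i → ∑-δ _ i (off-diagonal i)) ⟩
      ∑[ i < N ] (u i * v i * (H i · H i))
        ≡⟨ sum-cong-≗ (λ i → cong (λ r → u i * v i * r) (row-norm i)) ⟩
      ∑[ i < N ] (u i * v i * + N)
        ≡⟨ *-distribʳ-sum (+ N) (λ i → u i * v i) ⟨
      (u · v) * + N
        ≡⟨ ℤP.*-comm (u · v) (+ N) ⟩
      + N * (u · v) ∎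
      where
      open ≡-Reasoning
      term : Fin N → Fin N → Fin N → ℤ
      term i j m = u i * H i j * (v m * H m j)
      regroup : ∀ a b c d → a * b * (c * d) ≡ a * c * (b * d)
      regroup = solve-∀
      factor : ∀ i m → ∑[ j < N ] (u i * H i j * (v m * H m j)) ≡ u i * v m * (H i · H m)
      factor i m = trans (sum-cong-≗ (λ j → regroup (u i) (H i j) (v m) (H m j)))
                         (sym (*-distribˡ-sum (u i * v m) (λ j → H i j * H m j)))
      off-diagonal : ∀ i m → m ≢ i → u i * v m * (H i · H m) ≡ 0ℤ
      off-diagonal i m m≢i =
        trans (cong (λ r → u i * v m * r) (trans (sym (Σ≡∑ N (λ k → H i k * H m k))) (rows-orthogonal i m (m≢i ∘ sym))))
              (ℤP.*-zeroʳ (u i * v m))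

    -- The combination
    -- c = (column j)H has c_j = N and c·c = N·(column j · column j) = N², so its other
    -- entries, the inner products of column j with the other columns, vanish.
    columns-orthogonal : ∀ j k → k ≢ j → column j · column k ≡ 0ℤ
    columns-orthogonal j = squares-isolated (combine (column j)) j (begin
      combine (column j) · combine (column j)   ≡⟨ combine-inner (column j) (column j) ⟩
      + N * (column j · column j)               ≡⟨ cong (+ N *_) column-norm ⟩
      + N * + N                                 ≡⟨ cong₂ _*_ column-norm column-norm ⟨
      (column j · column j) * (column j · column j) ∎)
      where
      open ≡-Reasoning
      column-norm : column j · column j ≡ + N
      column-norm = dot-signs (λ i → entry-sign i j)

    φ-as-dot : ∀ a b → φ H (a , b) ≡ b · combine a
    φ-as-dot a b = begin
      Σ N (λ i → Σ N (λ j → a i * b j * H i j))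
        ≡⟨ trans (Σ≡∑ N (λ i → Σ N (λ j → a i * b j * H i j)))
                 (sum-cong-≗ (λ i → Σ≡∑ N (λ j → a i * b j * H i j))) ⟩
      ∑[ i < N ] ∑[ j < N ] (a i * b j * H i j)
        ≡⟨ ∑-comm (λ i j → a i * b j * H i j) ⟩
      ∑[ j < N ] ∑[ i < N ] (a i * b j * H i j)
        ≡⟨ sum-cong-≗ (λ j → trans (sum-cong-≗ (λ i → regroup (a i) (b j) (H i j)))
                                   (sym (*-distribˡ-sum (b j) (λ i → a i * H i j)))) ⟩
      ∑[ j < N ] (b j * combine a j) ∎
      where
      open ≡-Reasoning
      regroup : ∀ x y h → x * y * h ≡ y * (x * h)
      regroup = solve-∀

    module SignedColumnSums (N≡0 : + N ≡ 0ℤ [mod 4 ]) {a : SignVec N} (a-signs : IsSignVec a) where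

      t : Fin N → ℤ
      t = combine a

      -- Each t_j is a sum of N odd terms.
      t-even : ∀ j → t j ≡ 0ℤ [mod 2 ]
      t-even j = begin
        ∑[ i < N ] (a i * H i j)  ≈⟨ ∑-mod (λ i → sign-odd (sign-* (a-signs i) (entry-sign i j))) ⟩
        ∑[ i < N ] (+ 1)          ≡⟨ ∑-const N (+ 1) ⟩
        + N * + 1                 ≡⟨ ℤP.*-identityʳ (+ N) ⟩
        + N                       ≈⟨ mod-weaken 2 N≡0 ⟩
        0ℤ                        ∎
        where open ≡-mod-Reasoning 2

      -- Summing xy + yz ≡ xz + 1 down columns j and k: t_j + 0 ≡ t_k + N (mod 4).
      t-congruent : ∀ j k → t j ≡ t k [mod 4 ]
      t-congruent j k with k Fin.≟ j
      ... | yes refl = mod-reflexive refl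
      ... | no k≢j = begin
        t j                                           ≡⟨ ℤP.+-identityʳ (t j) ⟨
        t j + 0ℤ                                      ≡⟨ cong (_+_ (t j)) (columns-orthogonal j k k≢j) ⟨
        t j + column j · column k                     ≡⟨ ∑-distrib-+ (λ i → a i * H i j) (λ i → H i j * H i k) ⟨
        ∑[ i < N ] (a i * H i j + H i j * H i k)
          ≈⟨ ∑-mod (λ i → signs-mod-4 (a-signs i) (entry-sign i j) (entry-sign i k)) ⟩
        ∑[ i < N ] (a i * H i k + + 1)                ≡⟨ ∑-distrib-+ (λ i → a i * H i k) (λ _ → + 1) ⟩
        t k + ∑[ i < N ] (+ 1)                        ≡⟨ cong (_+_ (t k)) (trans (∑-const N (+ 1)) (ℤP.*-identityʳ (+ N))) ⟩
        t k + + N                                     ≈⟨ mod-+ˡ (t k) N≡0 ⟩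
        t k + 0ℤ                                      ≡⟨ ℤP.+-identityʳ (t k) ⟩
        t k                                           ∎
        where open ≡-mod-Reasoning 4

      -- Hence b·t ≡ N·t_{j₀} ≡ 0 (mod 4) for every sign vector b (j₀ any column).
      dot-mod-4 : Fin N → ∀ {b} → IsSignVec b → b · t ≡ 0ℤ [mod 4 ]
      dot-mod-4 j₀ {b} b-signs = begin
        ∑[ j < N ] (b j * t j)    ≈⟨ ∑-mod (λ j → sign-mod (b-signs j) (t-even j)) ⟩
        ∑[ j < N ] t j            ≈⟨ ∑-mod (λ j → t-congruent j j₀) ⟩
        ∑[ j < N ] t j₀           ≡⟨ ∑-const N (t j₀) ⟩
        + N * t j₀                ≈⟨ mod-*ʳ (t j₀) N≡0 ⟩
        0ℤ * t j₀                 ≡⟨⟩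
        0ℤ                        ∎
        where open ≡-mod-Reasoning 4

      -- If all t_j ≡ 0 (mod 4), say t_j = 4σ_j, then Σ t_j² = N² forces Σ σ_j ≡ N/4 (mod 2):
      -- indeed 4·Σ t_j ≡ Σ t_j² = N² ≡ 4N (mod 32).
      sum-mod-8 : (∀ j → t j ≡ 0ℤ [mod 4 ]) → ∑[ j < N ] t j ≡ + N [mod 8 ]
      sum-mod-8 t≡0 = mod-cancel 4 (begin
        + 4 * ∑[ j < N ] t j      ≡⟨ *-distribˡ-sum (+ 4) t ⟩
        ∑[ j < N ] (+ 4 * t j)    ≈⟨ ∑-mod (λ j → mod-sym (square-of-multiple 4 (t≡0 j))) ⟩
        t · t                     ≡⟨ combine-inner a a ⟩
        + N * (a · a)             ≡⟨ cong (+ N *_) (dot-signs a-signs) ⟩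
        + N * + N                 ≈⟨ square-of-multiple 4 N≡0 ⟩
        + 4 * + N                 ∎)
        where open ≡-mod-Reasoning 32

      -- So if one t_{j₀} ≡ 0 (mod 4), then b·t ≡ Σ t_j ≡ N (mod 8) for every sign vector b.
      dot-mod-8 : ∀ j₀ → t j₀ ≡ 0ℤ [mod 4 ] → ∀ {b} → IsSignVec b → b · t ≡ + N [mod 8 ]
      dot-mod-8 j₀ t₀≡0 {b} b-signs = begin
        ∑[ j < N ] (b j * t j)    ≈⟨ ∑-mod (λ j → sign-mod (b-signs j) (t≡0 j)) ⟩
        ∑[ j < N ] t j            ≈⟨ sum-mod-8 t≡0 ⟩
        + N                       ∎
        where
        open ≡-mod-Reasoning 8
        t≡0 : ∀ j → t j ≡ 0ℤ [mod 4 ]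
        t≡0 j = mod-trans (t-congruent j j₀) t₀≡0

  sumOver : ∀ {A : Set} → List A → (A → ℕ) → ℕ
  sumOver []       f = 0
  sumOver (x ∷ xs) f = f x ℕ.+ sumOver xs f

  indicator : Bool → ℕ
  indicator true  = 1
  indicator false = 0

  length-filter : ∀ {A : Set} (p : A → Bool) xs → length (filterᵇ p xs) ≡ sumOver xs (indicator ∘ p)
  length-filter p []       = refl
  length-filter p (x ∷ xs) with p x
  ... | true  = cong suc (length-filter p xs)
  ... | false = length-filter p xs

  sumOver-++ : ∀ {A : Set} (xs ys : List A) f → sumOver (xs ++ ys) f ≡ sumOver xs f ℕ.+ sumOver ys f
  sumOver-++ []       ys f = refl
  sumOver-++ (x ∷ xs) ys f = trans (cong (f x ℕ.+_) (sumOver-++ xs ys f)) (sym (ℕP.+-assoc (f x) _ _))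

  sumOver-map : ∀ {A B : Set} (g : A → B) xs f → sumOver (map g xs) f ≡ sumOver xs (f ∘ g)
  sumOver-map g []       f = refl
  sumOver-map g (x ∷ xs) f = cong (f (g x) ℕ.+_) (sumOver-map g xs f)

  sumOver-cartesian : ∀ {A B : Set} (xs : List A) (ys : List B) f →
    sumOver (cartesianProduct xs ys) f ≡ sumOver xs (λ x → sumOver ys (λ y → f (x , y)))
  sumOver-cartesian []       ys f = refl
  sumOver-cartesian (x ∷ xs) ys f = trans (sumOver-++ (map (x ,_) ys) _ f)
    (cong₂ ℕ._+_ (sumOver-map (x ,_) ys f) (sumOver-cartesian xs ys f))

  sumOver-cong : ∀ {A : Set} {P : A → Set} {xs} {f g : A → ℕ} → All P xs → (∀ x → P x → f x ≡ g x) →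
                 sumOver xs f ≡ sumOver xs g
  sumOver-cong []         f≡g = refl
  sumOver-cong (px ∷ pxs) f≡g = cong₂ ℕ._+_ (f≡g _ px) (sumOver-cong pxs f≡g)

  sumOver-+ : ∀ {A : Set} xs (f g : A → ℕ) → sumOver xs (λ x → f x ℕ.+ g x) ≡ sumOver xs f ℕ.+ sumOver xs g
  sumOver-+ []       f g = refl
  sumOver-+ (x ∷ xs) f g = trans (cong (f x ℕ.+ g x ℕ.+_) (sumOver-+ xs f g)) (interchange (f x) (g x) _ _)
    where
    interchange : ∀ a b c d → a ℕ.+ b ℕ.+ (c ℕ.+ d) ≡ a ℕ.+ c ℕ.+ (b ℕ.+ d)
    interchange = ℕSolver.solve-∀

  sumOver-const : ∀ {A : Set} {P : A → Set} {xs} {f : A → ℕ} c → All P xs → (∀ x → P x → f x ≡ c) →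
                  sumOver xs f ≡ length xs ℕ.* c
  sumOver-const c []         f≡c = refl
  sumOver-const c (px ∷ pxs) f≡c = cong₂ ℕ._+_ (f≡c _ px) (sumOver-const c pxs f≡c)

  sumOver-allSigns-suc : ∀ {n} (h : SignVec (suc n) → ℕ) →
    sumOver (allSigns (suc n)) h ≡ sumOver (allSigns n) (λ v → h (cons (+ 1) v) ℕ.+ h (cons -[1+ 0 ] v))
  sumOver-allSigns-suc {n} h = go (allSigns n)
    where
    go : ∀ vs → sumOver (concatMap (λ v → cons (+ 1) v ∷ cons -[1+ 0 ] v ∷ []) vs) h
                ≡ sumOver vs (λ v → h (cons (+ 1) v) ℕ.+ h (cons -[1+ 0 ] v))
    go []       = refl
    go (v ∷ vs) = trans (sym (ℕP.+-assoc (h (cons (+ 1) v)) _ _))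
                        (cong (h (cons (+ 1) v) ℕ.+ h (cons -[1+ 0 ] v) ℕ.+_) (go vs))

  cons-signs : ∀ {n x} {v : SignVec n} → IsSign x → IsSignVec v → IsSignVec (cons x v)
  cons-signs x-sign v-signs zero    = x-sign
  cons-signs x-sign v-signs (suc i) = v-signs i

  allSigns-signs : ∀ n → All IsSignVec (allSigns n)
  allSigns-signs zero    = (λ ()) ∷ []
  allSigns-signs (suc n) = pairs (allSigns n) (allSigns-signs n)
    where
    pairs : ∀ vs → All IsSignVec vs → All IsSignVec (concatMap (λ v → cons (+ 1) v ∷ cons -[1+ 0 ] v ∷ []) vs)
    pairs []       []                = []
    pairs (v ∷ vs) (v-signs ∷ signs) =
      cons-signs (inj₁ refl) v-signs ∷ cons-signs (inj₂ refl) v-signs ∷ pairs vs signs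

  allSigns-length : ∀ n → length (allSigns n) ≡ 2 ℕ.^ n
  allSigns-length zero    = refl
  allSigns-length (suc n) = begin
    length (allSigns (suc n))              ≡⟨ length≡count (allSigns (suc n)) ⟩
    sumOver (allSigns (suc n)) (λ _ → 1)   ≡⟨ sumOver-allSigns-suc {n} (λ _ → 1) ⟩
    sumOver (allSigns n) (λ _ → 2)         ≡⟨ sumOver-const 2 (allSigns-signs n) (λ _ _ → refl) ⟩
    length (allSigns n) ℕ.* 2              ≡⟨ cong (ℕ._* 2) (allSigns-length n) ⟩
    2 ℕ.^ n ℕ.* 2                          ≡⟨ ℕP.*-comm (2 ℕ.^ n) 2 ⟩
    2 ℕ.^ suc n                            ∎
    where
    open ≡-Reasoning
    length≡count : ∀ {A : Set} (xs : List A) → length xs ≡ sumOver xs (λ _ → 1)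
    length≡count []       = refl
    length≡count (x ∷ xs) = cong suc (length≡count xs)

  sumOver-signs-const : ∀ {n} {h : SignVec n → ℕ} c → (∀ v → IsSignVec v → h v ≡ c) →
                        sumOver (allSigns n) h ≡ 2 ℕ.^ n ℕ.* c
  sumOver-signs-const {n} c h≡c =
    trans (sumOver-const c (allSigns-signs n) h≡c) (cong (ℕ._* c) (allSigns-length n))

  sumOver-signs-pairs : ∀ {n} {h : SignVec (suc n) → ℕ} c →
    (∀ v → IsSignVec v → h (cons (+ 1) v) ℕ.+ h (cons -[1+ 0 ] v) ≡ c) → sumOver (allSigns (suc n)) h ≡ 2 ℕ.^ n ℕ.* c
  sumOver-signs-pairs {h = h} c pair≡c = trans (sumOver-allSigns-suc h) (sumOver-signs-const c pair≡c)

  count-as-sum : ∀ {N} (H : Matrix N) S →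
    count H S ≡ sumOver (allSigns N) (λ a → sumOver (allSigns N) (λ b → indicator (S (φ H (a , b)))))
  count-as-sum {N} H S = trans (length-filter _ (cartesianProduct (allSigns N) (allSigns N)))
                               (sumOver-cartesian (allSigns N) (allSigns N) (λ p → indicator (S (φ H p))))

  inResidue : ℕ → Subset
  inResidue r x = does (x %ℕ 8 ℕ.≟ r)

  -- The residues modulo 8 of multiples of 4.
  IsQuarter : ℕ → Set
  IsQuarter r = r ≡ 0 ⊎ r ≡ 4

  inResidue-of : ∀ {r s x} → IsQuarter s → x ≡ + s [mod 8 ] → inResidue r x ≡ does (s ℕ.≟ r)
  inResidue-of {r} s-quarter x≡s = cong (λ s → does (s ℕ.≟ r)) (residue (quarter<8 s-quarter) x≡s)
    where
    quarter<8 : ∀ {s} → IsQuarter s → s ℕ.< 8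
    quarter<8 (inj₁ refl) = ℕP.<ᵇ⇒< 0 8 _
    quarter<8 (inj₂ refl) = ℕP.<ᵇ⇒< 4 8 _

  exactly-one : ∀ {r} → IsQuarter r → indicator (does (4 ℕ.≟ r)) ℕ.+ indicator (does (0 ℕ.≟ r)) ≡ 1
  exactly-one (inj₁ refl) = refl
  exactly-one (inj₂ refl) = refl

  one-of-pair : ∀ {r x y} → IsQuarter r → x ≡ 0ℤ [mod 4 ] → y ≡ x + + 4 [mod 8 ] →
                indicator (inResidue r y) ℕ.+ indicator (inResidue r x) ≡ 1
  one-of-pair {r} {x} {y} r-quarter x≡0 y≡x+4 = by-class-of-x (mod-split 4 x≡0)
    where
    indicators : ∀ {s s′} → IsQuarter s → IsQuarter s′ → x ≡ + s [mod 8 ] → y ≡ + s′ [mod 8 ] →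
                 indicator (inResidue r y) ℕ.+ indicator (inResidue r x)
                   ≡ indicator (does (s′ ℕ.≟ r)) ℕ.+ indicator (does (s ℕ.≟ r))
    indicators s-quarter s′-quarter x≡s y≡s′ =
      cong₂ (λ u v → indicator u ℕ.+ indicator v) (inResidue-of s′-quarter y≡s′) (inResidue-of s-quarter x≡s)
    by-class-of-x : x ≡ 0ℤ [mod 8 ] ⊎ x ≡ + 4 [mod 8 ] → indicator (inResidue r y) ℕ.+ indicator (inResidue r x) ≡ 1
    by-class-of-x (inj₁ x≡0mod8) =
      trans (indicators (inj₁ refl) (inj₂ refl) x≡0mod8 (mod-trans y≡x+4 (mod-+ʳ (+ 4) x≡0mod8)))
            (exactly-one r-quarter)
    by-class-of-x (inj₂ x≡4mod8) =
      trans (indicators (inj₂ refl) (inj₁ refl) x≡4mod8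
                        (mod-trans y≡x+4 (mod-trans (mod-+ʳ (+ 4) x≡4mod8) (by-computation _))))
            (trans (ℕP.+-comm (indicator (does (0 ℕ.≟ r))) _) (exactly-one r-quarter))

  split-indicator : ∀ (S : Subset) {x} → x ≡ 0ℤ [mod 4 ] →
                    indicator (S x) ≡ indicator ((S ∩ eight0) x) ℕ.+ indicator ((S ∩ eight4) x)
  split-indicator S {x} x≡0 with mod-split 4 x≡0
  ... | inj₁ x≡0mod8 rewrite inResidue-of {0} (inj₁ refl) x≡0mod8 | inResidue-of {4} (inj₁ refl) x≡0mod8 = in-first (S x)
    where
    in-first : ∀ b → indicator b ≡ indicator (b ∧ true) ℕ.+ indicator (b ∧ false)
    in-first true  = refl
    in-first false = refl
  ... | inj₂ x≡4mod8 rewrite inResidue-of {0} (inj₂ refl) x≡4mod8 | inResidue-of {4} (inj₂ refl) x≡4mod8 = in-second (S x)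
    where
    in-second : ∀ b → indicator b ≡ indicator (b ∧ false) ℕ.+ indicator (b ∧ true)
    in-second true  = refl
    in-second false = refl

  module ResidueCounts {n} (H : Matrix (suc n))
           (entry-sign : ∀ i j → IsSign (H i j))
           (rows-orthogonal : ∀ i m → i ≢ m → Σ (suc n) (λ k → H i k * H m k) ≡ 0ℤ)
           (N≡0 : + suc n ≡ 0ℤ [mod 4 ]) where

    open HadamardAlgebra H entry-sign rows-orthogonal
    open SignedColumnSums N≡0 using (t-even; dot-mod-4; dot-mod-8)

    N : ℕ
    N = suc n

    φ-mod-4 : ∀ {a b} → IsSignVec a → IsSignVec b → φ H (a , b) ≡ 0ℤ [mod 4 ]
    φ-mod-4 {a} {b} a-signs b-signs = mod-trans (mod-reflexive (φ-as-dot a b)) (dot-mod-4 a-signs zero b-signs)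

    hits : ℕ → SignVec N → ℕ
    hits r a = sumOver (allSigns N) (λ b → indicator (inResidue r (φ H (a , b))))

    hits-of-class-0 : ∀ {r ρ a} → IsQuarter ρ → + N ≡ + ρ [mod 8 ] → IsSignVec a → combine a zero ≡ 0ℤ [mod 4 ] →
                      hits r a ≡ 2 ℕ.^ N ℕ.* indicator (does (ρ ℕ.≟ r))
    hits-of-class-0 {r} {ρ} {a} ρ-quarter N≡ρ a-signs t₀≡0 = sumOver-signs-const _ (λ b b-signs →
      cong indicator (inResidue-of ρ-quarter (mod-trans (mod-trans (mod-reflexive (φ-as-dot a b))
                                                                    (dot-mod-8 a-signs zero t₀≡0 b-signs)) N≡ρ)))

    -- If t₀ ≡ 2 (mod 4), flipping b₀ moves φ(a,b) by 2t₀ ≡ 4 (mod 8): half the b hit 8ℤ + r.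
    hits-of-class-2 : ∀ {r a} → IsQuarter r → IsSignVec a → combine a zero ≡ + 2 [mod 4 ] → hits r a ≡ 2 ℕ.^ n ℕ.* 1
    hits-of-class-2 {r} {a} r-quarter a-signs t₀≡2 = sumOver-signs-pairs 1 (λ v v-signs →
      one-of-pair r-quarter (φ-mod-4 a-signs (cons-signs (inj₂ refl) v-signs)) (begin
        φ H (a , cons (+ 1) v)                                    ≡⟨ φ-as-dot a (cons (+ 1) v) ⟩
        cons (+ 1) v · combine a                                  ≡⟨ flip-first v (combine a) ⟩
        cons -[1+ 0 ] v · combine a + + 2 * combine a zero        ≈⟨ mod-+ˡ (cons -[1+ 0 ] v · combine a) (mod-scale 2 t₀≡2) ⟩
        cons -[1+ 0 ] v · combine a + + 4                         ≡⟨ cong (_+ + 4) (φ-as-dot a (cons -[1+ 0 ] v)) ⟨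
        φ H (a , cons -[1+ 0 ] v) + + 4                           ∎))
      where open ≡-mod-Reasoning 8

    -- Flipping a₀ changes t₀ by 2H₀₀ ≡ 2 (mod 4).
    flip-t₀ : ∀ v → combine (cons (+ 1) v) zero ≡ combine (cons -[1+ 0 ] v) zero + + 2 [mod 4 ]
    flip-t₀ v = begin
      combine (cons (+ 1) v) zero                           ≡⟨ flip-first v (column zero) ⟩
      combine (cons -[1+ 0 ] v) zero + + 2 * H zero zero    ≈⟨ mod-+ˡ (combine (cons -[1+ 0 ] v) zero) (double-sign (entry-sign zero zero)) ⟩
      combine (cons -[1+ 0 ] v) zero + + 2                  ∎
      where open ≡-mod-Reasoning 4

    -- Of each pair (+1 ∷ v, −1 ∷ v) of row sign vectors one has t₀ ≡ 0 and the other t₀ ≡ 2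
    -- (mod 4); so 8ℤ + r receives 2^N·[ρ = r] + 2^n of the pairs (a,b) for each of the 2^n pairs.
    count-residue : ∀ {r ρ} → IsQuarter r → IsQuarter ρ → + N ≡ + ρ [mod 8 ] →
                    count H (inResidue r) ≡ 2 ℕ.^ n ℕ.* (2 ℕ.^ N ℕ.* indicator (does (ρ ℕ.≟ r)) ℕ.+ 2 ℕ.^ n ℕ.* 1)
    count-residue {r} {ρ} r-quarter ρ-quarter N≡ρ =
      trans (count-as-sum H (inResidue r)) (sumOver-signs-pairs _ pair-hits)
      where
      pair-hits : ∀ v → IsSignVec v → hits r (cons (+ 1) v) ℕ.+ hits r (cons -[1+ 0 ] v)
                                      ≡ 2 ℕ.^ N ℕ.* indicator (does (ρ ℕ.≟ r)) ℕ.+ 2 ℕ.^ n ℕ.* 1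
      pair-hits v v-signs = by-class-of-a⁻ (mod-split 2 (t-even a⁻-signs zero))
        where
        a⁺ a⁻ : SignVec N
        a⁺ = cons (+ 1) v
        a⁻ = cons -[1+ 0 ] v
        a⁺-signs : IsSignVec a⁺
        a⁺-signs = cons-signs (inj₁ refl) v-signs
        a⁻-signs : IsSignVec a⁻
        a⁻-signs = cons-signs (inj₂ refl) v-signs
        by-class-of-a⁻ : combine a⁻ zero ≡ 0ℤ [mod 4 ] ⊎ combine a⁻ zero ≡ + 2 [mod 4 ] →
                         hits r a⁺ ℕ.+ hits r a⁻ ≡ 2 ℕ.^ N ℕ.* indicator (does (ρ ℕ.≟ r)) ℕ.+ 2 ℕ.^ n ℕ.* 1
        by-class-of-a⁻ (inj₁ t⁻≡0) = trans (ℕP.+-comm (hits r a⁺) _) (cong₂ ℕ._+_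
          (hits-of-class-0 ρ-quarter N≡ρ a⁻-signs t⁻≡0)
          (hits-of-class-2 r-quarter a⁺-signs (mod-trans (flip-t₀ v) (mod-+ʳ (+ 2) t⁻≡0))))
        by-class-of-a⁻ (inj₂ t⁻≡2) = cong₂ ℕ._+_
          (hits-of-class-0 ρ-quarter N≡ρ a⁺-signs
            (mod-trans (flip-t₀ v) (mod-trans (mod-+ʳ (+ 2) t⁻≡2) (by-computation _))))
          (hits-of-class-2 r-quarter a⁻-signs t⁻≡2)

    -- Every value of φ lies in 8ℤ or 8ℤ + 4, so counts split along the two classes.
    count-split : ∀ S → count H S ≡ count H (S ∩ eight0) ℕ.+ count H (S ∩ eight4)
    count-split S = begin
      count H S
        ≡⟨ count-as-sum H S ⟩
      sumOver signs (λ a → sumOver signs (λ b → indicator (S (φ H (a , b)))))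
        ≡⟨ sumOver-cong (allSigns-signs N) (λ a a-signs → trans
             (sumOver-cong (allSigns-signs N) (λ b b-signs → split-indicator S (φ-mod-4 a-signs b-signs)))
             (sumOver-+ signs (λ b → indicator ((S ∩ eight0) (φ H (a , b))))
                              (λ b → indicator ((S ∩ eight4) (φ H (a , b)))))) ⟩
      sumOver signs (λ a → sumOver signs (λ b → indicator ((S ∩ eight0) (φ H (a , b))))
                           ℕ.+ sumOver signs (λ b → indicator ((S ∩ eight4) (φ H (a , b)))))
        ≡⟨ sumOver-+ signs _ _ ⟩
      sumOver signs (λ a → sumOver signs (λ b → indicator ((S ∩ eight0) (φ H (a , b)))))
        ℕ.+ sumOver signs (λ a → sumOver signs (λ b → indicator ((S ∩ eight4) (φ H (a , b)))))
        ≡⟨ cong₂ ℕ._+_ (count-as-sum H (S ∩ eight0)) (count-as-sum H (S ∩ eight4)) ⟨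
      count H (S ∩ eight0) ℕ.+ count H (S ∩ eight4) ∎
      where
      open ≡-Reasoning
      signs : List (SignVec N)
      signs = allSigns N

  /-+ : ∀ p q d .{{_ : NonZero d}} → p ℚ./ d ℚ.+ q ℚ./ d ≡ (p + q) ℚ./ d
  /-+ p q d@(suc k) = ℚP.toℚᵘ-injective (begin
    toℚᵘ (p ℚ./ d ℚ.+ q ℚ./ d)             ≈⟨ ℚP.toℚᵘ-homo-+ (p ℚ./ d) (q ℚ./ d) ⟩
    toℚᵘ (p ℚ./ d) ℚᵘ.+ toℚᵘ (q ℚ./ d)     ≈⟨ ℚᵘP.+-cong (ℚP.toℚᵘ-fromℚᵘ (mkℚᵘ p k)) (ℚP.toℚᵘ-fromℚᵘ (mkℚᵘ q k)) ⟩
    mkℚᵘ p k ℚᵘ.+ mkℚᵘ q k                 ≈⟨ *≡* common-denominator ⟩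
    mkℚᵘ (p + q) k                         ≈⟨ ℚP.toℚᵘ-fromℚᵘ (mkℚᵘ (p + q) k) ⟨
    toℚᵘ ((p + q) ℚ./ d)                   ∎)
    where
    open ℚᵘP.≃-Reasoning
    factor : ∀ a b e → (a * e + b * e) * e ≡ (a + b) * (e * e)
    factor = solve-∀
    common-denominator : (p * + d + q * + d) * + d ≡ (p + q) * + (d ℕ.* d)
    common-denominator = trans (factor p q (+ d)) (cong ((p + q) *_) (ℤP.pos-* d d))

  /-cross : ∀ p q d e .{{_ : NonZero d}} .{{_ : NonZero e}} → p * + e ≡ q * + d → p ℚ./ d ≡ q ℚ./ e
  /-cross p q (suc d) (suc e) pe≡qd = ℚP.fromℚᵘ-cong {mkℚᵘ p d} {mkℚᵘ q e} (*≡* pe≡qd)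

  fraction≢0 : ∀ k d .{{_ : NonZero d}} → + suc k ℚ./ d ≢ 0ℚ
  fraction≢0 k d k/d≡0 = contradiction (trans (sym (ℚP.↥-/ (+ suc k) d)) (cong (λ q → ℚ.↥ q * gcd (+ suc k) (+ d)) k/d≡0)) λ ()

  mixture : ∀ (μ : Measure) E E′ → (∀ S → μ S ≡ μ (S ∩ E) ℚ.+ μ (S ∩ E′)) → μ E ≢ 0ℚ → μ E′ ≢ 0ℚ →
            ∀ S → μ S ≡ μ E ℚ.* restrictRescale μ E S ℚ.+ μ E′ ℚ.* restrictRescale μ E′ S
  mixture μ E E′ μ-split μE≢0 μE′≢0 S =
    trans (μ-split S) (sym (cong₂ ℚ._+_ (restores E μE≢0) (restores E′ μE′≢0)))
    where
    restores : ∀ F → μ F ≢ 0ℚ → μ F ℚ.* restrictRescale μ F S ≡ μ (S ∩ F)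
    restores F μF≢0 with μ F ℚ.≟ 0ℚ
    ... | yes μF≡0 = contradiction μF≡0 μF≢0
    ... | no  _    = begin
      μ F ℚ.* (μ (S ∩ F) ℚ.* ℚ.1/ μ F)     ≡⟨ cong (μ F ℚ.*_) (ℚP.*-comm (μ (S ∩ F)) _) ⟩
      μ F ℚ.* (ℚ.1/ μ F ℚ.* μ (S ∩ F))     ≡⟨ ℚP.*-assoc (μ F) _ (μ (S ∩ F)) ⟨
      μ F ℚ.* ℚ.1/ μ F ℚ.* μ (S ∩ F)       ≡⟨ cong (ℚ._* μ (S ∩ F)) (ℚP.*-inverseʳ (μ F)) ⟩
      ℚ.1ℚ ℚ.* μ (S ∩ F)                   ≡⟨ ℚP.*-identityˡ (μ (S ∩ F)) ⟩
      μ (S ∩ F)                            ∎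
      where
      open ≡-Reasoning
      instance
        _ : ℚ.NonZero (μ F)
        _ = ℚ.≢-nonZero μF≢0

  4^n≡2^n*2^n : ∀ n → 4 ℕ.^ n ≡ 2 ℕ.^ n ℕ.* 2 ℕ.^ n
  4^n≡2^n*2^n n = begin
    (2 ℕ.^ 2) ℕ.^ n          ≡⟨ ℕP.^-*-assoc 2 2 n ⟩
    2 ℕ.^ (n ℕ.+ (n ℕ.+ 0))  ≡⟨ cong (λ k → 2 ℕ.^ (n ℕ.+ k)) (ℕP.+-identityʳ n) ⟩
    2 ℕ.^ (n ℕ.+ n)          ≡⟨ ℕP.^-distribˡ-+-* 2 n n ⟩
    2 ℕ.^ n ℕ.* 2 ℕ.^ n      ∎
    where open ≡-Reasoning

  module Glow {n} (H : Matrix (suc n))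
           (entry-sign : ∀ i j → IsSign (H i j))
           (rows-orthogonal : ∀ i m → i ≢ m → Σ (suc n) (λ k → H i k * H m k) ≡ 0ℤ)
           {ρ} (ρ-quarter : IsQuarter ρ) (N≡ρ : + suc n ≡ + ρ [mod 8 ]) where

    N : ℕ
    N = suc n

    N≡0 : + N ≡ 0ℤ [mod 4 ]
    N≡0 = mod-trans (mod-weaken 2 N≡ρ) (quarter≡0 ρ-quarter)
      where
      quarter≡0 : ∀ {r} → IsQuarter r → + r ≡ 0ℤ [mod 4 ]
      quarter≡0 (inj₁ refl) = by-computation _
      quarter≡0 (inj₂ refl) = by-computation _

    open ResidueCounts H entry-sign rows-orthogonal N≡0 using (count-residue; count-split)

    instance
      4^N≢0 : NonZero (4 ℕ.^ N)
      4^N≢0 = ℕP.m^n≢0 4 N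

    glow-residue : ∀ {r} → IsQuarter r → glow H (inResidue r) ≡ + (1 ℕ.+ 2 ℕ.* indicator (does (ρ ℕ.≟ r))) ℚ./ 4
    glow-residue {r} r-quarter = /-cross (+ count H (inResidue r)) (+ (1 ℕ.+ 2 ℕ.* δ)) (4 ℕ.^ N) 4 (begin
      + count H (inResidue r) * + 4                 ≡⟨ ℤP.pos-* (count H (inResidue r)) 4 ⟨
      + (count H (inResidue r) ℕ.* 4)               ≡⟨ cong (λ c → + (c ℕ.* 4)) (count-residue r-quarter ρ-quarter N≡ρ) ⟩
      + (x ℕ.* (2 ℕ.* x ℕ.* δ ℕ.+ x ℕ.* 1) ℕ.* 4)   ≡⟨ cong +_ (quarters x δ) ⟩
      + ((1 ℕ.+ 2 ℕ.* δ) ℕ.* (4 ℕ.* (x ℕ.* x)))     ≡⟨ cong (λ y → + ((1 ℕ.+ 2 ℕ.* δ) ℕ.* (4 ℕ.* y))) (4^n≡2^n*2^n n) ⟨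
      + ((1 ℕ.+ 2 ℕ.* δ) ℕ.* 4 ℕ.^ N)               ≡⟨ ℤP.pos-* (1 ℕ.+ 2 ℕ.* δ) (4 ℕ.^ N) ⟩
      + (1 ℕ.+ 2 ℕ.* δ) * + (4 ℕ.^ N)               ∎)
      where
      open ≡-Reasoning
      x δ : ℕ
      x = 2 ℕ.^ n
      δ = indicator (does (ρ ℕ.≟ r))
      quarters : ∀ x δ → x ℕ.* (2 ℕ.* x ℕ.* δ ℕ.+ x ℕ.* 1) ℕ.* 4 ≡ (1 ℕ.+ 2 ℕ.* δ) ℕ.* (4 ℕ.* (x ℕ.* x))
      quarters = ℕSolver.solve-∀

    glow-split : ∀ S → glow H S ≡ glow H (S ∩ eight0) ℚ.+ glow H (S ∩ eight4)
    glow-split S = begin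
      + count H S ℚ./ 4 ℕ.^ N
        ≡⟨ cong (ℚ._/ 4 ℕ.^ N) (trans (cong +_ (count-split S)) (ℤP.pos-+ (count H (S ∩ eight0)) _)) ⟩
      (+ count H (S ∩ eight0) + + count H (S ∩ eight4)) ℚ./ 4 ℕ.^ N
        ≡⟨ /-+ (+ count H (S ∩ eight0)) (+ count H (S ∩ eight4)) (4 ℕ.^ N) ⟨
      + count H (S ∩ eight0) ℚ./ 4 ℕ.^ N ℚ.+ + count H (S ∩ eight4) ℚ./ 4 ℕ.^ N ∎
      where open ≡-Reasoning

    glow-mixture : ∀ S → glow H S ≡ glow H eight0 ℚ.* μeven H S ℚ.+ glow H eight4 ℚ.* μodd H S
    glow-mixture = mixture (glow H) eight0 eight4 glow-split (glow≢0 (inj₁ refl)) (glow≢0 (inj₂ refl))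
      where
      glow≢0 : ∀ {r} → IsQuarter r → glow H (inResidue r) ≢ 0ℚ
      glow≢0 {r} r-quarter =
        subst (_≢ 0ℚ) (sym (glow-residue r-quarter)) (fraction≢0 (2 ℕ.* indicator (does (ρ ℕ.≟ r))) 4)


open import Data.Nat using (ℕ; _≤_; _%_)
open import Data.Product using (_×_)
open import Data.Integer using (+_)
open import Data.Rational using (_/_; _*_; _+_)
open import Relation.Binary.PropositionalEquality using (_≡_)

open GlowOfHadamardMatrices using (module Glow; mod-of-%)
open import Data.Nat using (suc)
open import Data.Product using (_,_)
open import Data.Sum using (inj₁; inj₂)
open import Relation.Binary.PropositionalEquality using (refl; trans; cong₂)

theorem2p23 : (N : ℕ) → 4 ≤ N → (H : Matrix N) → IsHadamard N H →
    (N % 8 ≡ 0 → ∀ (S : Subset) →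
    glow H S ≡ (+ 3 / 4) * μeven H S + (+ 1 / 4) * μodd H S)
    × (N % 8 ≡ 4 → ∀ (S : Subset) →
    glow H S ≡ (+ 1 / 4) * μeven H S + (+ 3 / 4) * μodd H S)
theorem2p23 (suc n) _ H (entry-sign , rows-orthogonal) = N≡0-mod-8 , N≡4-mod-8
  where
  N≡0-mod-8 : suc n % 8 ≡ 0 → ∀ S → glow H S ≡ (+ 3 / 4) * μeven H S + (+ 1 / 4) * μodd H S
  N≡0-mod-8 N%8≡0 S = trans (glow-mixture S)
    (cong₂ (λ p q → p * μeven H S + q * μodd H S) (glow-residue (inj₁ refl)) (glow-residue (inj₂ refl)))
    where open Glow H entry-sign rows-orthogonal (inj₁ refl) (mod-of-% N%8≡0)
  N≡4-mod-8 : suc n % 8 ≡ 4 → ∀ S → glow H S ≡ (+ 1 / 4) * μeven H S + (+ 3 / 4) * μodd H S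
  N≡4-mod-8 N%8≡4 S = trans (glow-mixture S)
    (cong₂ (λ p q → p * μeven H S + q * μodd H S) (glow-residue (inj₁ refl)) (glow-residue (inj₂ refl)))
    where open Glow H entry-sign rows-orthogonal (inj₂ refl) (mod-of-% N%8≡4)
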